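{- Let $n\ge3$, and let $G,G'$ be the thrackles corresponding to two maximal simplices $\Delta,\Delta'$ of $\Gamma_{2,n}$. Then $\Delta$ and $\Delta'$ share a common facet if and only if there are four distinct vertices $a-1,a,b,b+1$ (taken modulo $n$) such that $G$ contains the edges $(a,b)$, $(a-1,b)$ and $(b+1,a)$, and $G'$ is obtained from $G$ by replacing the edge $(a,b)$ by the edge $(a-1,b+1)$.
   Context: For $I\subseteq[n]$, $\epsilon_I\in\mathbb{R}^n$ is the 0/1 indicator vector. For 2-subsets $I,J$ with $(s_1,\dots,s_4)$ the nondecreasing ordering of their multiset union, $U(I,J)=\{s_1,s_3\}$, $V(I,J)=\{s_2,s_4\}$; $(I,J)$ is sorted if $I=U(I,J)$, $J=V(I,J)$; a collection $(I_1,\dots,I_r)$ is sorted if all pairs $(I_i,I_j)$, $i<j$, are sorted. $\Gamma_{2,n}$ is the triangulation of $\mathrm{conv}\{\epsilon_I:|I|=2\}$ with maximal simplices $\mathrm{conv}\{\epsilon_{I_1},\dots,\epsilon_{I_n}\}$ for maximal sorted collections $(I_1,\dots,I_n)$. The thrackle of such a simplex is the graph on $[n]$ with edge set $\{I_1,\dots,I_n\}$, drawn with vertices on a circle labelled clockwise in increasing order and edges as chords; in a thrackle every two edges intersect (sharing an endpoint counts). Vertex labels are taken modulo $n$. -}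

module Defs where

open import Data.Nat using (ℕ; zero; suc; _+_; _≤_; _<_)
open import Data.Nat.DivMod using (_mod_)
open import Data.Fin using (Fin; toℕ)
open import Data.Product using (_×_; _,_; Σ; ∃; ∃-syntax)
open import Data.Sum using (_⊎_)
open import Data.List using (List)
open import Data.List.Membership.Propositional using (_∈_)
open import Data.List.Relation.Unary.All using (All)
open import Data.List.Relation.Unary.AllPairs using (AllPairs)
open import Data.List.Relation.Unary.Unique.Propositional using (Unique)
open import Relation.Binary.PropositionalEquality using (_≡_; _≢_)
open import Relation.Nullary using (¬_)
open import Function.Bundles using (_⇔_)

-- Vertices of the thrackle / ground set [n] are Fin n (labels 0..n-1,
-- clockwise in increasing order).  A 2-subset {i,j} with i < j is
-- represented by the ordered pair (i , j) satisfying WF.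
Edge : ℕ → Set
Edge n = Fin n × Fin n

WF : ∀ {n} → Edge n → Set
WF (i , j) = toℕ i < toℕ j

-- (I,J) sorted, i.e. I = U(I,J), J = V(I,J).  For I = {i1<i2},
-- J = {j1<j2}, the sorted multiset union s1≤s2≤s3≤s4 has
-- {s1,s3} = I and {s2,s4} = J exactly when i1 ≤ j1 ≤ i2 ≤ j2.
SortedPair : ∀ {n} → Edge n → Edge n → Set
SortedPair (i₁ , i₂) (j₁ , j₂) = toℕ i₁ ≤ toℕ j₁ × toℕ j₁ ≤ toℕ i₂ × toℕ i₂ ≤ toℕ j₂

SortedColl : ∀ {n} → List (Edge n) → Set
SortedColl l = Unique l × All WF l × AllPairs SortedPair l

MaximalSorted : ∀ {n} → List (Edge n) → Set
MaximalSorted {n} l =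
  SortedColl l ×
  ((l' : List (Edge n)) → SortedColl l' →
     (∀ e → e ∈ l → e ∈ l') → ∀ e → e ∈ l' → e ∈ l)

SameSet : ∀ {n} → List (Edge n) → List (Edge n) → Set
SameSet {n} l l' = (e : Edge n) → (e ∈ l) ⇔ (e ∈ l')

-- The simplices conv{ε_I : I ∈ l} and conv{ε_I : I ∈ l'} share a common
-- facet: removing one vertex from each yields the same vertex set
-- (the ε_I are distinct, so simplices/facets correspond to their vertex sets).
ShareFacet : ∀ {n} → List (Edge n) → List (Edge n) → Set
ShareFacet {n} l l' =
  Σ (Edge n) λ e → e ∈ l × Σ (Edge n) λ e' → e' ∈ l' ×
    ((x : Edge n) → (x ∈ l × x ≢ e) ⇔ (x ∈ l' × x ≢ e'))

sucMod : ∀ {n} → Fin n → Fin n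
sucMod {suc k} i = suc (toℕ i) mod suc k

predMod : ∀ {n} → Fin n → Fin n
predMod {suc k} i = (toℕ i + k) mod suc k

HasEdge : ∀ {n} → List (Edge n) → Fin n → Fin n → Set
HasEdge l x y = (x , y) ∈ l ⊎ (y , x) ∈ l

SameEdge : ∀ {n} → Fin n → Fin n → Fin n → Fin n → Set
SameEdge x y u v = (x ≡ u × y ≡ v) ⊎ (x ≡ v × y ≡ u)

Distinct4 : ∀ {n} → Fin n → Fin n → Fin n → Fin n → Set
Distinct4 p q r s = p ≢ q × p ≢ r × p ≢ s × q ≢ r × q ≢ s × r ≢ s

Flip : ∀ {n} → List (Edge n) → List (Edge n) → Fin n → Fin n → Set
Flip {n} G G' a b =
  Distinct4 (predMod a) a b (sucMod b) ×
  HasEdge G a b × HasEdge G (predMod a) b × HasEdge G (sucMod b) a ×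
  ((x y : Fin n) →
     HasEdge G' x y ⇔
       ((HasEdge G x y × ¬ SameEdge x y a b) ⊎ SameEdge x y (predMod a) (sucMod b)))

module Submission where

-- A maximal sorted collection G contains every edge that intersects all of its edges, because such
-- an edge can be inserted into the sorted list.  If G and G′ share a facet, G loses one edge e and
-- G′ gains one edge e′, and every common edge meets both; by maximality e and e′ do not intersect,
-- so e = {a, b} and e′ = {c, d} with c, a, b, d in cyclic order.  Of the four ways to cut this
-- cyclic order open, two (e′ nested in e, e′ to the right of e) are treated directly and the other
-- two follow by exchanging the roles of G and G′.  A chord from the arc [c, a] to the arc [b, d]
-- meets every edge meeting both e and e′, hence lies in G as soon as it meets e.  This puts {c, b}
-- and {d, a} into G, and a vertex strictly between c and a (or b and d) would yield an edge of G
-- other than e missing e′; so c = a − 1 and d = b + 1.  Conversely, a flip exchanges exactly one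
-- edge, and maximality of G′ keeps the new edge out of G.

open import Defs
open import Data.Nat using (ℕ; zero; suc; _+_; _%_; _≤_; _<_; _≤?_; z≤n; s≤s; s≤s⁻¹)
open import Data.Nat.Properties
  using (≤-refl; ≤-reflexive; ≤-trans; ≤-antisym; <⇒≤; <-trans; <-asym; ≤-<-trans; <-≤-trans; <⇒≱; <-cmp; ≰⇒>;
         m≤n⇒m<n∨m≡n; +-suc; n<1+n)
open import Data.Nat.DivMod using (m<n⇒m%n≡m; [m+n]%n≡m%n; n%n≡0; %-distribˡ-+)
open import Data.Fin.Base as Fin using (Fin; toℕ; fromℕ<) renaming (zero to fzero)
open import Data.Fin.Properties using (toℕ-injective; toℕ<n; toℕ-fromℕ<; <⇒≢) renaming (_≟_ to _≟ᶠ_)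
open import Data.Product using (_×_; _,_; Σ; ∃-syntax; proj₁; proj₂; uncurry)
open import Data.Product.Properties using (≡-dec)
open import Data.Sum using (_⊎_; inj₁; inj₂; fromInj₂)
import Data.Sum as Sum
open import Data.List using (List; []; _∷_)
open import Data.List.Membership.Propositional using (_∈_; _∉_)
import Data.List.Membership.DecPropositional as DecMembership
open import Data.List.Relation.Unary.Any using (here; there)
open import Data.List.Relation.Unary.All using (All; []; _∷_)
import Data.List.Relation.Unary.All as All
open import Data.List.Relation.Unary.AllPairs using (AllPairs; []; _∷_)
open import Data.List.Relation.Binary.Permutation.Propositional using (_↭_; prep; swap; ↭-refl; ↭-sym; ↭-trans; ↭⇒↭ₛ)
open import Data.List.Relation.Binary.Permutation.Propositional.Properties using (All-resp-↭; ∈-resp-↭)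
import Data.List.Relation.Binary.Permutation.Setoid.Properties as PermutationSetoid
open import Data.Empty using (⊥; ⊥-elim)
open import Function using (_∘_)
open import Function.Bundles using (_⇔_; mk⇔; Equivalence)
open import Function.Properties.Equivalence using () renaming (sym to ⇔-sym)
open import Relation.Nullary using (¬_; Dec; yes; no)
open import Relation.Nullary.Decidable using (_×-dec_)
open import Relation.Binary.Definitions using (tri<; tri≈; tri>)
open import Relation.Binary.PropositionalEquality using (_≡_; _≢_; refl; sym; trans; cong; cong₂; subst; ≢-sym; setoid; module ≡-Reasoning)

open Equivalence using (to; from)

-- For edges i₁ < i₂ and j₁ < j₂ this says that the two chords cross or share an endpoint.
Intersect : ∀ {n} → Edge n → Edge n → Set
Intersect g h = SortedPair g h ⊎ SortedPair h g

_≟ₑ_ : ∀ {n} (g h : Edge n) → Dec (g ≡ h)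
_≟ₑ_ = ≡-dec _≟ᶠ_ _≟ᶠ_

sortedPair? : ∀ {n} (g h : Edge n) → Dec (SortedPair g h)
sortedPair? (i₁ , i₂) (j₁ , j₂) = toℕ i₁ ≤? toℕ j₁ ×-dec toℕ j₁ ≤? toℕ i₂ ×-dec toℕ i₂ ≤? toℕ j₂

SortedPair-cycle⇒≡ : ∀ {n} {g h k : Edge n} → SortedPair g h → SortedPair h k → SortedPair k g → g ≡ h
SortedPair-cycle⇒≡ (g₁≤h₁ , _ , g₂≤h₂) (h₁≤k₁ , _ , h₂≤k₂) (k₁≤g₁ , _ , k₂≤g₂) =
  cong₂ _,_ (toℕ-injective (≤-antisym g₁≤h₁ (≤-trans h₁≤k₁ k₁≤g₁)))
            (toℕ-injective (≤-antisym g₂≤h₂ (≤-trans h₂≤k₂ k₂≤g₂)))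

AllPairs⇒Intersect : ∀ {n} {l : List (Edge n)} → AllPairs SortedPair l →
  ∀ {g h} → g ∈ l → h ∈ l → g ≢ h → Intersect g h
AllPairs⇒Intersect (_ ∷ _)  (here refl) (here refl) g≢h = ⊥-elim (g≢h refl)
AllPairs⇒Intersect (g≤ ∷ _) (here refl) (there h∈l) _   = inj₁ (All.lookup g≤ h∈l)
AllPairs⇒Intersect (h≤ ∷ _) (there g∈l) (here refl) _   = inj₂ (All.lookup h≤ g∈l)
AllPairs⇒Intersect (_ ∷ l)  (there g∈l) (there h∈l) g≢h = AllPairs⇒Intersect l g∈l h∈l g≢h

insertSorted : ∀ {n} (h : Edge n) (l : List (Edge n)) → h ∉ l → (∀ {g} → g ∈ l → Intersect h g) →
  AllPairs SortedPair l → Σ (List (Edge n)) λ l′ → l′ ↭ h ∷ l × AllPairs SortedPair l′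
insertSorted h [] _ _ [] = h ∷ [] , ↭-refl , [] ∷ []
insertSorted h (g ∷ l) h∉ h⌢ (g≤l ∷ sorted) with sortedPair? h g
... | yes h≤g = h ∷ g ∷ l , ↭-refl , All.tabulate h≤ ∷ g≤l ∷ sorted
  where
  h≤ : ∀ {k} → k ∈ g ∷ l → SortedPair h k
  h≤ (here refl) = h≤g
  h≤ (there k∈l) with h⌢ (there k∈l)
  ... | inj₁ h≤k = h≤k
  ... | inj₂ k≤h = ⊥-elim (h∉ (here (SortedPair-cycle⇒≡ h≤g (All.lookup g≤l k∈l) k≤h)))
... | no h≰g with insertSorted h l (h∉ ∘ there) (h⌢ ∘ there) sorted
...   | l′ , l′↭ , sorted′ =
  g ∷ l′ , ↭-trans (prep g l′↭) (swap g h ↭-refl) , All-resp-↭ (↭-sym l′↭) (g≤h ∷ g≤l) ∷ sorted′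
  where
  g≤h : SortedPair g h
  g≤h = fromInj₂ (⊥-elim ∘ h≰g) (h⌢ (here refl))

Saturated : ∀ {n} → List (Edge n) → Set
Saturated {n} G = (h : Edge n) → WF h → (∀ {g} → g ∈ G → Intersect h g) → h ∈ G

maximal⇒saturated : ∀ {n} {G : List (Edge n)} → MaximalSorted G → Saturated G
maximal⇒saturated {n} {G} ((unique , wf , sorted) , maximal) h wf-h h⌢ with DecMembership._∈?_ _≟ₑ_ h G
... | yes h∈G = h∈G
... | no h∉G with insertSorted h G h∉G h⌢ sorted
...   | l′ , l′↭ , sorted′ = maximal l′ collection (λ _ → grow ∘ there) h (grow (here refl))
  where
  grow : ∀ {g} → g ∈ h ∷ G → g ∈ l′
  grow = ∈-resp-↭ (↭-sym l′↭)
  collection : SortedColl l′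
  collection =
    PermutationSetoid.Unique-resp-↭ (setoid (Edge n)) (↭⇒↭ₛ (↭-sym l′↭))
      (All.tabulate (λ g∈G h≡g → h∉G (subst (_∈ G) (sym h≡g) g∈G)) ∷ unique) ,
    All-resp-↭ (↭-sym l′↭) (wf-h ∷ wf) , sorted′

data Apart {n} : Edge n → Edge n → Set where
  encloses : ∀ {x₁ x₂ y₁ y₂} → toℕ x₁ < toℕ y₁ → toℕ y₂ < toℕ x₂ → Apart (x₁ , x₂) (y₁ , y₂)
  precedes : ∀ {x₁ x₂ y₁ y₂} → toℕ x₂ < toℕ y₁ → Apart (x₁ , x₂) (y₁ , y₂)

Apart⇒¬Intersect : ∀ {n} {e e′ : Edge n} → Apart e e′ → ¬ Intersect e e′
Apart⇒¬Intersect (encloses _ y₂<x₂)     (inj₁ (_ , _ , x₂≤y₂))  = <⇒≱ y₂<x₂ x₂≤y₂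
Apart⇒¬Intersect (encloses x₁<y₁ _)     (inj₂ (y₁≤x₁ , _ , _))  = <⇒≱ x₁<y₁ y₁≤x₁
Apart⇒¬Intersect (precedes x₂<y₁)       (inj₁ (_ , y₁≤x₂ , _))  = <⇒≱ x₂<y₁ y₁≤x₂
Apart⇒¬Intersect (precedes x₂<y₁)       (inj₂ (y₁≤x₁ , x₁≤y₂ , y₂≤x₂)) =
  <⇒≱ x₂<y₁ (≤-trans y₁≤x₁ (≤-trans x₁≤y₂ y₂≤x₂))

<∧¬Intersect⇒Apart : ∀ {n} {x₁ x₂ y₁ y₂ : Fin n} → toℕ x₁ < toℕ y₁ →
  ¬ Intersect (x₁ , x₂) (y₁ , y₂) → Apart (x₁ , x₂) (y₁ , y₂)
<∧¬Intersect⇒Apart {x₂ = x₂} {y₁} {y₂} x₁<y₁ ∩̸ with toℕ y₁ ≤? toℕ x₂ | toℕ x₂ ≤? toℕ y₂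
... | no y₁≰x₂  | _         = precedes (≰⇒> y₁≰x₂)
... | yes y₁≤x₂ | yes x₂≤y₂ = ⊥-elim (∩̸ (inj₁ (<⇒≤ x₁<y₁ , y₁≤x₂ , x₂≤y₂)))
... | yes _     | no x₂≰y₂  = encloses x₁<y₁ (≰⇒> x₂≰y₂)

¬Intersect⇒Apart : ∀ {n} {e e′ : Edge n} → WF e → WF e′ → ¬ Intersect e e′ → Apart e e′ ⊎ Apart e′ e
¬Intersect⇒Apart {e = x₁ , x₂} {y₁ , y₂} x₁<x₂ y₁<y₂ ∩̸ with <-cmp (toℕ x₁) (toℕ y₁)
... | tri< x₁<y₁ _ _ = inj₁ (<∧¬Intersect⇒Apart x₁<y₁ ∩̸)
... | tri> _ _ y₁<x₁ = inj₂ (<∧¬Intersect⇒Apart y₁<x₁ (∩̸ ∘ Sum.swap))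
... | tri≈ _ x₁≡y₁ _ with toℕ x₂ ≤? toℕ y₂
...   | yes x₂≤y₂ = ⊥-elim (∩̸ (inj₁ (≤-reflexive x₁≡y₁ , subst (_≤ toℕ x₂) x₁≡y₁ (<⇒≤ x₁<x₂) , x₂≤y₂)))
...   | no x₂≰y₂  = ⊥-elim (∩̸ (inj₂ (≤-reflexive (sym x₁≡y₁) , subst (_≤ toℕ y₂) (sym x₁≡y₁) (<⇒≤ y₁<y₂) ,
                                      <⇒≤ (≰⇒> x₂≰y₂))))

-- A chord meeting both e = (x₁, x₂) and the chord e′ = (y₁, y₂) nested strictly inside it has one end
-- in [y₁, y₂] and the other outside (x₁, x₂); so it meets every chord from [x₁, y₁] to [y₂, x₂].
Intersect-across-enclosed : ∀ {n} {x₁ x₂ y₁ y₂ v u : Fin n} {g : Edge n} →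
  toℕ x₁ < toℕ y₁ → toℕ y₂ < toℕ x₂ →
  toℕ x₁ ≤ toℕ v → toℕ v ≤ toℕ y₁ → toℕ y₂ ≤ toℕ u → toℕ u ≤ toℕ x₂ →
  Intersect g (x₁ , x₂) → Intersect g (y₁ , y₂) → Intersect (v , u) g
Intersect-across-enclosed _ _ x₁≤v v≤y₁ y₂≤u _ (inj₁ (p≤x₁ , _ , _)) (inj₁ (_ , y₁≤q , q≤y₂)) =
  inj₂ (≤-trans p≤x₁ x₁≤v , ≤-trans v≤y₁ y₁≤q , ≤-trans q≤y₂ y₂≤u)
Intersect-across-enclosed x₁<y₁ _ _ _ _ _ (inj₁ (p≤x₁ , _ , _)) (inj₂ (y₁≤p , _ , _)) =
  ⊥-elim (<⇒≱ x₁<y₁ (≤-trans y₁≤p p≤x₁))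
Intersect-across-enclosed _ y₂<x₂ _ _ _ _ (inj₂ (_ , _ , x₂≤q)) (inj₁ (_ , _ , q≤y₂)) =
  ⊥-elim (<⇒≱ y₂<x₂ (≤-trans x₂≤q q≤y₂))
Intersect-across-enclosed _ _ _ v≤y₁ y₂≤u u≤x₂ (inj₂ (_ , _ , x₂≤q)) (inj₂ (y₁≤p , p≤y₂ , _)) =
  inj₁ (≤-trans v≤y₁ y₁≤p , ≤-trans p≤y₂ y₂≤u , ≤-trans u≤x₂ x₂≤q)

Intersect-both-preceded⇒spans : ∀ {n} {x₁ x₂ y₁ y₂ p q : Fin n} → toℕ x₂ < toℕ y₁ →
  Intersect (p , q) (x₁ , x₂) → Intersect (p , q) (y₁ , y₂) →
  toℕ x₁ ≤ toℕ p × toℕ p ≤ toℕ x₂ × toℕ y₁ ≤ toℕ q × toℕ q ≤ toℕ y₂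
Intersect-both-preceded⇒spans x₂<y₁ (inj₁ (_ , _ , q≤x₂)) (inj₁ (_ , y₁≤q , _)) =
  ⊥-elim (<⇒≱ x₂<y₁ (≤-trans y₁≤q q≤x₂))
Intersect-both-preceded⇒spans x₂<y₁ (inj₁ (p≤x₁ , x₁≤q , q≤x₂)) (inj₂ (y₁≤p , _ , _)) =
  ⊥-elim (<⇒≱ x₂<y₁ (≤-trans y₁≤p (≤-trans p≤x₁ (≤-trans x₁≤q q≤x₂))))
Intersect-both-preceded⇒spans _ (inj₂ (x₁≤p , p≤x₂ , _)) (inj₁ (_ , y₁≤q , q≤y₂)) =
  x₁≤p , p≤x₂ , y₁≤q , q≤y₂
Intersect-both-preceded⇒spans x₂<y₁ (inj₂ (_ , p≤x₂ , _)) (inj₂ (y₁≤p , _ , _)) =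
  ⊥-elim (<⇒≱ x₂<y₁ (≤-trans y₁≤p p≤x₂))

Intersect-across-precedingˡ : ∀ {n} {x₁ x₂ y₁ y₂ u v : Fin n} {g : Edge n} → toℕ x₂ < toℕ y₁ →
  toℕ u ≤ toℕ x₁ → toℕ x₂ ≤ toℕ v → toℕ v ≤ toℕ y₁ →
  Intersect g (x₁ , x₂) → Intersect g (y₁ , y₂) → Intersect (u , v) g
Intersect-across-precedingˡ x₂<y₁ u≤x₁ x₂≤v v≤y₁ g∩e g∩e′
  with Intersect-both-preceded⇒spans x₂<y₁ g∩e g∩e′
... | x₁≤p , p≤x₂ , y₁≤q , _ = inj₁ (≤-trans u≤x₁ x₁≤p , ≤-trans p≤x₂ x₂≤v , ≤-trans v≤y₁ y₁≤q)

Intersect-across-precedingʳ : ∀ {n} {x₁ x₂ y₁ y₂ v u : Fin n} {g : Edge n} → toℕ x₂ < toℕ y₁ →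
  toℕ x₂ ≤ toℕ v → toℕ v ≤ toℕ y₁ → toℕ y₂ ≤ toℕ u →
  Intersect g (x₁ , x₂) → Intersect g (y₁ , y₂) → Intersect (v , u) g
Intersect-across-precedingʳ x₂<y₁ x₂≤v v≤y₁ y₂≤u g∩e g∩e′
  with Intersect-both-preceded⇒spans x₂<y₁ g∩e g∩e′
... | _ , p≤x₂ , y₁≤q , q≤y₂ = inj₂ (≤-trans p≤x₂ x₂≤v , ≤-trans v≤y₁ y₁≤q , ≤-trans q≤y₂ y₂≤u)

toℕ-sucMod : ∀ {k} (x : Fin (suc k)) → toℕ (sucMod x) ≡ suc (toℕ x) % suc k
toℕ-sucMod _ = toℕ-fromℕ< _

predMod-sucMod : ∀ {k} (x : Fin (suc k)) → predMod (sucMod x) ≡ x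
predMod-sucMod {k} x = toℕ-injective (begin
  toℕ (predMod (sucMod x))        ≡⟨ toℕ-fromℕ< _ ⟩
  (toℕ (sucMod x) + k) % m        ≡⟨ cong (λ t → (t + k) % m) (toℕ-sucMod x) ⟩
  (suc (toℕ x) % m + k) % m       ≡⟨ cong (λ t → (suc (toℕ x) % m + t) % m) (sym (m<n⇒m%n≡m (n<1+n k))) ⟩
  (suc (toℕ x) % m + k % m) % m   ≡⟨ sym (%-distribˡ-+ (suc (toℕ x)) k m) ⟩
  (suc (toℕ x) + k) % m           ≡⟨ cong (_% m) (sym (+-suc (toℕ x) k)) ⟩
  (toℕ x + m) % m                 ≡⟨ [m+n]%n≡m%n (toℕ x) m ⟩
  toℕ x % m                       ≡⟨ m<n⇒m%n≡m (toℕ<n x) ⟩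
  toℕ x                           ∎)
  where
  open ≡-Reasoning
  m : ℕ
  m = suc k

no-gap⇒sucMod : ∀ {k} {x y : Fin (suc k)} → toℕ x < toℕ y →
  (∀ (w : Fin (suc k)) → toℕ x < toℕ w → toℕ w < toℕ y → ⊥) → sucMod x ≡ y
no-gap⇒sucMod {k} {x} {y} x<y gap with m≤n⇒m<n∨m≡n x<y
... | inj₂ 1+x≡y = toℕ-injective (trans (toℕ-sucMod x) (trans (cong (_% suc k) 1+x≡y) (m<n⇒m%n≡m (toℕ<n y))))
... | inj₁ 1+x<y = ⊥-elim (gap w (≤-reflexive (sym w≡1+x)) (subst (_< toℕ y) (sym w≡1+x) 1+x<y))
  where
  w : Fin (suc k)
  w = fromℕ< (<-trans 1+x<y (toℕ<n y))
  w≡1+x : toℕ w ≡ suc (toℕ x)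
  w≡1+x = toℕ-fromℕ< (<-trans 1+x<y (toℕ<n y))

nothing-below⇒zero : ∀ {k} {x : Fin (suc k)} → (∀ (w : Fin (suc k)) → toℕ w < toℕ x → ⊥) → toℕ x ≡ 0
nothing-below⇒zero {x = fzero}   _     = refl
nothing-below⇒zero {x = Fin.suc x} below = ⊥-elim (below fzero (s≤s z≤n))

nothing-above⇒last : ∀ {k} {y : Fin (suc k)} → (∀ (w : Fin (suc k)) → toℕ y < toℕ w → ⊥) → toℕ y ≡ k
nothing-above⇒last {k} {y} above with m≤n⇒m<n∨m≡n (s≤s⁻¹ (toℕ<n y))
... | inj₂ y≡k = y≡k
... | inj₁ y<k = ⊥-elim (above (fromℕ< {suc (toℕ y)} (s≤s y<k))
                                (≤-reflexive (sym (toℕ-fromℕ< {suc (toℕ y)} (s≤s y<k)))))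

wrap⇒sucMod : ∀ {k} {x y : Fin (suc k)} →
  (∀ (w : Fin (suc k)) → toℕ w < toℕ x → ⊥) → (∀ (w : Fin (suc k)) → toℕ y < toℕ w → ⊥) → sucMod y ≡ x
wrap⇒sucMod {k} {x} {y} below above = toℕ-injective (begin
  toℕ (sucMod y)        ≡⟨ toℕ-sucMod y ⟩
  suc (toℕ y) % suc k   ≡⟨ cong (λ t → suc t % suc k) (nothing-above⇒last above) ⟩
  suc k % suc k         ≡⟨ n%n≡0 (suc k) ⟩
  0                     ≡⟨ sym (nothing-below⇒zero below) ⟩
  toℕ x                 ∎)
  where open ≡-Reasoning

Joins : ∀ {n} → Edge n → Fin n → Fin n → Set
Joins (u , v) = SameEdge u v

SameEdge-sym : ∀ {n} {x y u v : Fin n} → SameEdge x y u v → SameEdge u v x y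
SameEdge-sym (inj₁ (refl , refl)) = inj₁ (refl , refl)
SameEdge-sym (inj₂ (refl , refl)) = inj₂ (refl , refl)

SameEdge-trans : ∀ {n} {x y u v s t : Fin n} → SameEdge x y u v → SameEdge u v s t → SameEdge x y s t
SameEdge-trans (inj₁ (refl , refl)) (inj₁ (refl , refl)) = inj₁ (refl , refl)
SameEdge-trans (inj₁ (refl , refl)) (inj₂ (refl , refl)) = inj₂ (refl , refl)
SameEdge-trans (inj₂ (refl , refl)) (inj₁ (refl , refl)) = inj₂ (refl , refl)
SameEdge-trans (inj₂ (refl , refl)) (inj₂ (refl , refl)) = inj₁ (refl , refl)

SameEdge-swap : ∀ {n} {x y u v : Fin n} → SameEdge x y u v → SameEdge x y v u
SameEdge-swap = Sum.swap

SameEdge⇒endpoint : ∀ {n} {x y u v : Fin n} → SameEdge x y u v → x ≡ u ⊎ x ≡ v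
SameEdge⇒endpoint = Sum.map proj₁ proj₁

HasEdge-sym : ∀ {n} {G : List (Edge n)} {x y} → HasEdge G x y → HasEdge G y x
HasEdge-sym = Sum.swap

Joins⇒HasEdge : ∀ {n} {G : List (Edge n)} {g x y} → g ∈ G → Joins g x y → HasEdge G x y
Joins⇒HasEdge g∈G (inj₁ (refl , refl)) = inj₁ g∈G
Joins⇒HasEdge g∈G (inj₂ (refl , refl)) = inj₂ g∈G

HasEdge⇒Joins : ∀ {n} {G : List (Edge n)} {x y} → HasEdge G x y → ∃[ g ] g ∈ G × Joins g x y
HasEdge⇒Joins (inj₁ xy∈G) = _ , xy∈G , inj₁ (refl , refl)
HasEdge⇒Joins (inj₂ yx∈G) = _ , yx∈G , inj₂ (refl , refl)

HasEdge⇒∈ : ∀ {n} {G : List (Edge n)} {x y} → All WF G → WF (x , y) → HasEdge G x y → (x , y) ∈ G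
HasEdge⇒∈ _  _   (inj₁ xy∈G) = xy∈G
HasEdge⇒∈ wf x<y (inj₂ yx∈G) = ⊥-elim (<-asym x<y (All.lookup wf yx∈G))

Joins-injective : ∀ {n} {g h : Edge n} {x y} → WF g → WF h → Joins g x y → Joins h x y → g ≡ h
Joins-injective _   _   (inj₁ (refl , refl)) (inj₁ (refl , refl)) = refl
Joins-injective _   _   (inj₂ (refl , refl)) (inj₂ (refl , refl)) = refl
Joins-injective x<y y<x (inj₁ (refl , refl)) (inj₂ (refl , refl)) = ⊥-elim (<-asym x<y y<x)
Joins-injective y<x x<y (inj₂ (refl , refl)) (inj₁ (refl , refl)) = ⊥-elim (<-asym x<y y<x)

record FlipWitness {k} (G : List (Edge (suc k))) (e e′ : Edge (suc k)) : Set where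
  field
    c a b d  : Fin (suc k)
    e≈ab     : Joins e a b
    e′≈cd    : Joins e′ c d
    distinct : Distinct4 c a b d
    c↦a      : sucMod c ≡ a
    b↦d      : sucMod b ≡ d
    cb∈G     : HasEdge G c b
    da∈G     : HasEdge G d a

FlipWitness-swap : ∀ {k} {G G′ : List (Edge (suc k))} {e e′} → FlipWitness G′ e′ e →
  (∀ {x y} → HasEdge G′ x y → ¬ Joins e′ x y → HasEdge G x y) → FlipWitness G e e′
FlipWitness-swap {e′ = e′} w@record { distinct = c≢a , c≢b , c≢d , a≢b , a≢d , b≢d } transfer = record
  { c = b ; a = d ; b = c ; d = a
  ; e≈ab = SameEdge-swap e′≈cd
  ; e′≈cd = SameEdge-swap e≈ab
  ; distinct = b≢d , ≢-sym c≢b , ≢-sym a≢b , ≢-sym c≢d , ≢-sym a≢d , c≢a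
  ; c↦a = b↦d
  ; b↦d = c↦a
  ; cb∈G = HasEdge-sym (transfer cb∈G (avoids c≢a c≢b))
  ; da∈G = HasEdge-sym (transfer da∈G (avoids (≢-sym a≢d) (≢-sym b≢d)))
  }
  where
  open FlipWitness w hiding (distinct)
  avoids : ∀ {x y} → x ≢ a → x ≢ b → ¬ Joins e′ x y
  avoids x≢a x≢b e′≈xy = Sum.[ x≢a , x≢b ] (SameEdge⇒endpoint (SameEdge-trans (SameEdge-sym e′≈xy) e≈ab))

module Straddling {n} {G : List (Edge n)} (saturated : Saturated G) {e e′ : Edge n}
  (straddles : ∀ {g} → g ∈ G → g ≢ e → Intersect g e × Intersect g e′)
  where

  extend : ∀ {h} → WF h → Intersect h e → (∀ {g} → Intersect g e → Intersect g e′ → Intersect h g) → h ∈ G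
  extend {h} wf-h h∩e h∩straddling = saturated h wf-h h∩
    where
    h∩ : ∀ {g} → g ∈ G → Intersect h g
    h∩ {g} g∈G with g ≟ₑ e
    ... | yes refl = h∩e
    ... | no g≢e = uncurry h∩straddling (straddles g∈G g≢e)

  misses-e′ : ∀ {h} → h ∈ G → h ≢ e → ¬ Apart h e′
  misses-e′ h∈G h≢e h⊥e′ = Apart⇒¬Intersect h⊥e′ (proj₂ (straddles h∈G h≢e))

module FlipConfiguration {k} {G : List (Edge (suc k))} (saturated : Saturated G)
  {x₁ x₂ y₁ y₂ : Fin (suc k)}
  (straddles : ∀ {g} → g ∈ G → g ≢ (x₁ , x₂) → Intersect g (x₁ , x₂) × Intersect g (y₁ , y₂))
  where

  open Straddling saturated straddles

  flip-enclosing : toℕ x₁ < toℕ y₁ → toℕ y₁ < toℕ y₂ → toℕ y₂ < toℕ x₂ →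
    FlipWitness G (x₁ , x₂) (y₁ , y₂)
  flip-enclosing x₁<y₁ y₁<y₂ y₂<x₂ = record
    { c = y₂ ; a = x₂ ; b = x₁ ; d = y₁
    ; e≈ab = inj₂ (refl , refl)
    ; e′≈cd = inj₂ (refl , refl)
    ; distinct = <⇒≢ y₂<x₂ , ≢-sym (<⇒≢ x₁<y₂) , ≢-sym (<⇒≢ y₁<y₂) ,
                 ≢-sym (<⇒≢ x₁<x₂) , ≢-sym (<⇒≢ y₁<x₂) , <⇒≢ x₁<y₁
    ; c↦a = no-gap⇒sucMod y₂<x₂ gap-right
    ; b↦d = no-gap⇒sucMod x₁<y₁ gap-left
    ; cb∈G = inj₂ (fan-left ≤-refl (<⇒≤ y₂<x₂))
    ; da∈G = inj₁ (fan-right (<⇒≤ x₁<y₁) ≤-refl)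
    }
    where
    x₁<y₂ : toℕ x₁ < toℕ y₂
    x₁<y₂ = <-trans x₁<y₁ y₁<y₂
    y₁<x₂ : toℕ y₁ < toℕ x₂
    y₁<x₂ = <-trans y₁<y₂ y₂<x₂
    x₁<x₂ : toℕ x₁ < toℕ x₂
    x₁<x₂ = <-trans x₁<y₂ y₂<x₂

    fan-left : ∀ {u} → toℕ y₂ ≤ toℕ u → toℕ u ≤ toℕ x₂ → (x₁ , u) ∈ G
    fan-left {u} y₂≤u u≤x₂ = extend x₁<u (inj₁ (≤-refl , <⇒≤ x₁<u , u≤x₂))
        (Intersect-across-enclosed x₁<y₁ y₂<x₂ ≤-refl (<⇒≤ x₁<y₁) y₂≤u u≤x₂)
      where
      x₁<u : toℕ x₁ < toℕ u
      x₁<u = <-≤-trans x₁<y₂ y₂≤u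

    fan-right : ∀ {v} → toℕ x₁ ≤ toℕ v → toℕ v ≤ toℕ y₁ → (v , x₂) ∈ G
    fan-right {v} x₁≤v v≤y₁ = extend v<x₂ (inj₂ (x₁≤v , <⇒≤ v<x₂ , ≤-refl))
        (Intersect-across-enclosed x₁<y₁ y₂<x₂ x₁≤v v≤y₁ (<⇒≤ y₂<x₂) ≤-refl)
      where
      v<x₂ : toℕ v < toℕ x₂
      v<x₂ = ≤-<-trans v≤y₁ y₁<x₂

    gap-left : ∀ (w : Fin (suc k)) → toℕ x₁ < toℕ w → toℕ w < toℕ y₁ → ⊥
    gap-left w x₁<w w<y₁ = misses-e′ (fan-right (<⇒≤ x₁<w) (<⇒≤ w<y₁))
      (≢-sym (<⇒≢ x₁<w) ∘ cong proj₁) (encloses w<y₁ y₂<x₂)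

    gap-right : ∀ (w : Fin (suc k)) → toℕ y₂ < toℕ w → toℕ w < toℕ x₂ → ⊥
    gap-right w y₂<w w<x₂ = misses-e′ (fan-left (<⇒≤ y₂<w) (<⇒≤ w<x₂))
      (<⇒≢ w<x₂ ∘ cong proj₂) (encloses x₁<y₁ y₂<w)

  flip-preceding : toℕ x₁ < toℕ x₂ → toℕ x₂ < toℕ y₁ → toℕ y₁ < toℕ y₂ →
    FlipWitness G (x₁ , x₂) (y₁ , y₂)
  flip-preceding x₁<x₂ x₂<y₁ y₁<y₂ = record
    { c = y₂ ; a = x₁ ; b = x₂ ; d = y₁
    ; e≈ab = inj₁ (refl , refl)
    ; e′≈cd = inj₂ (refl , refl)
    ; distinct = ≢-sym (<⇒≢ x₁<y₂) , ≢-sym (<⇒≢ x₂<y₂) , ≢-sym (<⇒≢ y₁<y₂) ,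
                 <⇒≢ x₁<x₂ , <⇒≢ x₁<y₁ , <⇒≢ x₂<y₁
    ; c↦a = wrap⇒sucMod gap-below gap-above
    ; b↦d = no-gap⇒sucMod x₂<y₁ gap-middle
    ; cb∈G = inj₂ (fan-right ≤-refl)
    ; da∈G = inj₂ (fan-middle (<⇒≤ x₂<y₁) ≤-refl)
    }
    where
    x₁<y₁ : toℕ x₁ < toℕ y₁
    x₁<y₁ = <-trans x₁<x₂ x₂<y₁
    x₂<y₂ : toℕ x₂ < toℕ y₂
    x₂<y₂ = <-trans x₂<y₁ y₁<y₂
    x₁<y₂ : toℕ x₁ < toℕ y₂
    x₁<y₂ = <-trans x₁<y₁ y₁<y₂

    fan-left : ∀ {u} → toℕ u ≤ toℕ x₁ → (u , x₂) ∈ G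
    fan-left u≤x₁ = extend (≤-<-trans u≤x₁ x₁<x₂) (inj₁ (u≤x₁ , <⇒≤ x₁<x₂ , ≤-refl))
      (Intersect-across-precedingˡ x₂<y₁ u≤x₁ ≤-refl (<⇒≤ x₂<y₁))

    fan-middle : ∀ {v} → toℕ x₂ ≤ toℕ v → toℕ v ≤ toℕ y₁ → (x₁ , v) ∈ G
    fan-middle x₂≤v v≤y₁ = extend (<-≤-trans x₁<x₂ x₂≤v) (inj₂ (≤-refl , <⇒≤ x₁<x₂ , x₂≤v))
      (Intersect-across-precedingˡ x₂<y₁ ≤-refl x₂≤v v≤y₁)

    fan-right : ∀ {u} → toℕ y₂ ≤ toℕ u → (x₂ , u) ∈ G
    fan-right {u} y₂≤u = extend x₂<u (inj₂ (<⇒≤ x₁<x₂ , ≤-refl , <⇒≤ x₂<u))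
        (Intersect-across-precedingʳ x₂<y₁ ≤-refl (<⇒≤ x₂<y₁) y₂≤u)
      where
      x₂<u : toℕ x₂ < toℕ u
      x₂<u = <-≤-trans x₂<y₂ y₂≤u

    gap-below : ∀ (w : Fin (suc k)) → toℕ w < toℕ x₁ → ⊥
    gap-below w w<x₁ = misses-e′ (fan-left (<⇒≤ w<x₁)) (<⇒≢ w<x₁ ∘ cong proj₁) (precedes x₂<y₁)

    gap-middle : ∀ (w : Fin (suc k)) → toℕ x₂ < toℕ w → toℕ w < toℕ y₁ → ⊥
    gap-middle w x₂<w w<y₁ = misses-e′ (fan-middle (<⇒≤ x₂<w) (<⇒≤ w<y₁))
      (≢-sym (<⇒≢ x₂<w) ∘ cong proj₂) (precedes w<y₁)

    gap-above : ∀ (w : Fin (suc k)) → toℕ y₂ < toℕ w → ⊥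
    gap-above w y₂<w = misses-e′ (fan-right (<⇒≤ y₂<w))
      (≢-sym (<⇒≢ x₁<x₂) ∘ cong proj₁) (encloses x₂<y₁ y₂<w)

Facet : ∀ {n} → List (Edge n) → List (Edge n) → Edge n → Edge n → Set
Facet {n} G G′ e e′ = (x : Edge n) → (x ∈ G × x ≢ e) ⇔ (x ∈ G′ × x ≢ e′)

Facet-sym : ∀ {n} {G G′ : List (Edge n)} {e e′} → Facet G G′ e e′ → Facet G′ G e′ e
Facet-sym facet x = ⇔-sym (facet x)

Facet-diagonal⇒⊆ : ∀ {n} {G G′ : List (Edge n)} {e} → e ∈ G′ → Facet G G′ e e → ∀ {x} → x ∈ G → x ∈ G′
Facet-diagonal⇒⊆ {e = e} e∈G′ facet {x} x∈G with x ≟ₑ e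
... | yes refl = e∈G′
... | no x≢e = proj₁ (to (facet x) (x∈G , x≢e))

Flip-intro : ∀ {n} {G G′ : List (Edge n)} {a b c d} → predMod a ≡ c → sucMod b ≡ d →
  Distinct4 c a b d → HasEdge G a b → HasEdge G c b → HasEdge G d a →
  (∀ x y → HasEdge G′ x y ⇔ ((HasEdge G x y × ¬ SameEdge x y a b) ⊎ SameEdge x y c d)) →
  Flip G G′ a b
Flip-intro refl refl distinct G∋ab G∋cb G∋da exchange = distinct , G∋ab , G∋cb , G∋da , exchange

module Exchange {k} {G G′ : List (Edge (suc k))} (maxG : MaximalSorted G) (maxG′ : MaximalSorted G′)
  {e e′} (e∈G : e ∈ G) (e′∈G′ : e′ ∈ G′) (facet : Facet G G′ e e′)
  where

  private
    wf-G : All WF G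
    wf-G = proj₁ (proj₂ (proj₁ maxG))
    wf-G′ : All WF G′
    wf-G′ = proj₁ (proj₂ (proj₁ maxG′))
    sorted-G : AllPairs SortedPair G
    sorted-G = proj₂ (proj₂ (proj₁ maxG))
    sorted-G′ : AllPairs SortedPair G′
    sorted-G′ = proj₂ (proj₂ (proj₁ maxG′))

  straddles : ∀ {g} → g ∈ G → g ≢ e → Intersect g e × Intersect g e′
  straddles {g} g∈G g≢e with to (facet g) (g∈G , g≢e)
  ... | g∈G′ , g≢e′ =
    AllPairs⇒Intersect sorted-G g∈G e∈G g≢e , AllPairs⇒Intersect sorted-G′ g∈G′ e′∈G′ g≢e′

  open Straddling (maximal⇒saturated maxG) straddles

  e≡e′⇒SameSet : e ≡ e′ → SameSet G G′
  e≡e′⇒SameSet refl x = mk⇔ (Facet-diagonal⇒⊆ e′∈G′ facet) (Facet-diagonal⇒⊆ e∈G (Facet-sym facet))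

  ¬Intersect : e ≢ e′ → ¬ Intersect e e′
  ¬Intersect e≢e′ e∩e′ = proj₂ (to (facet e′) (e′∈G , e≢e′ ∘ sym)) refl
    where
    e′∈G : e′ ∈ G
    e′∈G = extend (All.lookup wf-G′ e′∈G′) (Sum.swap e∩e′) (λ _ g∩e′ → Sum.swap g∩e′)

  witness : Apart e e′ → FlipWitness G e e′
  witness (encloses x₁<y₁ y₂<x₂) =
    FlipConfiguration.flip-enclosing (maximal⇒saturated maxG) straddles x₁<y₁ (All.lookup wf-G′ e′∈G′) y₂<x₂
  witness (precedes x₂<y₁) =
    FlipConfiguration.flip-preceding (maximal⇒saturated maxG) straddles
      (All.lookup wf-G e∈G) x₂<y₁ (All.lookup wf-G′ e′∈G′)

  HasEdge-transfer : ∀ {x y} → HasEdge G x y → ¬ Joins e x y → HasEdge G′ x y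
  HasEdge-transfer G∋xy e≉xy with HasEdge⇒Joins G∋xy
  ... | g , g∈G , g≈xy = Joins⇒HasEdge (proj₁ (to (facet g) (g∈G , λ { refl → e≉xy g≈xy }))) g≈xy

  HasEdge-exchange : ∀ {a b c d} → Joins e a b → Joins e′ c d → ∀ x y →
    HasEdge G′ x y ⇔ ((HasEdge G x y × ¬ SameEdge x y a b) ⊎ SameEdge x y c d)
  HasEdge-exchange {a} {b} {c} {d} e≈ab e′≈cd x y = mk⇔ forth back
    where
    forth : HasEdge G′ x y → (HasEdge G x y × ¬ SameEdge x y a b) ⊎ SameEdge x y c d
    forth G′∋xy with HasEdge⇒Joins G′∋xy
    ... | g , g∈G′ , g≈xy with g ≟ₑ e′
    ...   | yes refl = inj₂ (SameEdge-trans (SameEdge-sym g≈xy) e′≈cd)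
    ...   | no g≢e′ with from (facet g) (g∈G′ , g≢e′)
    ...     | g∈G , g≢e = inj₁ (Joins⇒HasEdge g∈G g≈xy , λ xy≈ab →
                g≢e (Joins-injective (All.lookup wf-G g∈G) (All.lookup wf-G e∈G) g≈xy
                                     (SameEdge-trans e≈ab (SameEdge-sym xy≈ab))))
    back : (HasEdge G x y × ¬ SameEdge x y a b) ⊎ SameEdge x y c d → HasEdge G′ x y
    back (inj₁ (G∋xy , xy≉ab)) = HasEdge-transfer G∋xy (λ e≈xy → xy≉ab (SameEdge-trans (SameEdge-sym e≈xy) e≈ab))
    back (inj₂ xy≈cd) = Joins⇒HasEdge e′∈G′ (SameEdge-trans e′≈cd (SameEdge-sym xy≈cd))

  flip : FlipWitness G e e′ → Σ (Fin (suc k)) λ a → Σ (Fin (suc k)) λ b → Flip G G′ a b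
  flip w = a , b ,
    Flip-intro (trans (cong predMod (sym c↦a)) (predMod-sucMod c)) b↦d distinct
      (Joins⇒HasEdge e∈G e≈ab) cb∈G da∈G (HasEdge-exchange e≈ab e′≈cd)
    where open FlipWitness w

ShareFacet⇒Flip : ∀ {k} {G G′ : List (Edge (suc k))} → MaximalSorted G → MaximalSorted G′ →
  ¬ SameSet G G′ → ShareFacet G G′ → Σ (Fin (suc k)) λ a → Σ (Fin (suc k)) λ b → Flip G G′ a b
ShareFacet⇒Flip {G = G} maxG maxG′ G≉G′ (e , e∈G , e′ , e′∈G′ , facet) =
  E.flip (witness (¬Intersect⇒Apart (wf maxG e∈G) (wf maxG′ e′∈G′) (E.¬Intersect (G≉G′ ∘ E.e≡e′⇒SameSet))))
  where
  module E = Exchange maxG maxG′ e∈G e′∈G′ facet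
  module E′ = Exchange maxG′ maxG e′∈G′ e∈G (Facet-sym facet)
  wf : ∀ {m} {l : List (Edge m)} {g : Edge m} → MaximalSorted l → g ∈ l → WF g
  wf ((_ , wf-l , _) , _) = All.lookup wf-l
  witness : Apart e e′ ⊎ Apart e′ e → FlipWitness G e e′
  witness (inj₁ e⊥e′) = E.witness e⊥e′
  witness (inj₂ e′⊥e) = FlipWitness-swap (E′.witness e′⊥e) E′.HasEdge-transfer

Flip⇒ShareFacet : ∀ {n} {G G′ : List (Edge n)} {a b} → MaximalSorted G → MaximalSorted G′ →
  Flip G G′ a b → ShareFacet G G′
Flip⇒ShareFacet {G = G} {G′} {a} {b} maxG@((_ , wf-G , _) , _) ((_ , wf-G′ , _) , maximalG′)
  ((p≢a , _ , _ , _ , a≢s , _) , G∋ab , _ , _ , exchange)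
  with HasEdge⇒Joins G∋ab | HasEdge⇒Joins (from (exchange (predMod a) (sucMod b)) (inj₂ (inj₁ (refl , refl))))
... | e , e∈G , e≈ab | e′ , e′∈G′ , e′≈ps = e , e∈G , e′ , e′∈G′ , λ x → mk⇔ (forth x) (back x)
  where
  back : ∀ x → x ∈ G′ × x ≢ e′ → x ∈ G × x ≢ e
  back x (x∈G′ , x≢e′) with to (exchange (proj₁ x) (proj₂ x)) (inj₁ x∈G′)
  ... | inj₁ (G∋x , x≉ab) = HasEdge⇒∈ wf-G (All.lookup wf-G′ x∈G′) G∋x , λ { refl → x≉ab e≈ab }
  ... | inj₂ x≈ps = ⊥-elim (x≢e′ (Joins-injective (All.lookup wf-G′ x∈G′) (All.lookup wf-G′ e′∈G′)
                                    (inj₁ (refl , refl)) (SameEdge-trans e′≈ps (SameEdge-sym x≈ps))))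

  ab∉G′ : ¬ HasEdge G′ a b
  ab∉G′ G′∋ab with to (exchange a b) G′∋ab
  ... | inj₁ (_ , ab≉ab) = ab≉ab (inj₁ (refl , refl))
  ... | inj₂ ab≈ps = Sum.[ p≢a ∘ sym , a≢s ] (SameEdge⇒endpoint ab≈ps)

  forth : ∀ x → x ∈ G × x ≢ e → x ∈ G′ × x ≢ e′
  forth x (x∈G , x≢e) = x∈G′ , x≢e′
    where
    x∈G′ : x ∈ G′
    x∈G′ = HasEdge⇒∈ wf-G′ (All.lookup wf-G x∈G) (from (exchange (proj₁ x) (proj₂ x))
      (inj₁ (inj₁ x∈G , λ x≈ab → x≢e (Joins-injective (All.lookup wf-G x∈G) (All.lookup wf-G e∈G) x≈ab e≈ab))))
    -- If e′ were in G then G′ ⊆ G, so maximality of G′ would put e into G′.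
    x≢e′ : x ≢ e′
    x≢e′ refl = ab∉G′ (Joins⇒HasEdge (maximalG′ G (proj₁ maxG) G′⊆G e e∈G) e≈ab)
      where
      G′⊆G : ∀ z → z ∈ G′ → z ∈ G
      G′⊆G z z∈G′ with z ≟ₑ x
      ... | yes refl = x∈G
      ... | no z≢x = proj₁ (back z (z∈G′ , z≢x))

proposition5p5 : (n : ℕ) → 3 ≤ n → (G G' : List (Edge n)) →
    MaximalSorted G → MaximalSorted G' → ¬ SameSet G G' →
    ShareFacet G G' ⇔ Σ (Fin n) (λ a → Σ (Fin n) (λ b → Flip G G' a b))
proposition5p5 zero () _ _ _ _ _
proposition5p5 (suc k) _ G G′ maxG maxG′ G≉G′ =
  mk⇔ (ShareFacet⇒Flip maxG maxG′ G≉G′) (λ (_ , _ , flip) → Flip⇒ShareFacet maxG maxG′ flip)
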